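{- Let $D$ be a (not necessarily simple) $2$-edge connected, $3$-regular acyclic directed graph on $2n$ vertices with a unique source and a unique sink. Then $D$ has at most $2^n+1$ source-to-sink paths. Moreover, for every $n\ge 1$ there is such a graph on $2n$ vertices with exactly $2^n+1$ source-to-sink paths.
   Context: A directed multigraph is $3$-regular if every vertex is incident to exactly three edges counted with multiplicity; it is $2$-edge connected if its underlying undirected multigraph remains connected after deleting any single edge. Acyclic means no directed cycle. A source-to-sink path is a directed path from the source to the sink. -}

module Defs where

open import Data.Nat using (ℕ; zero; suc; _+_)
open import Data.Fin using (Fin; _≟_)
open import Data.List using (List; []; _∷_; map; length; filter; allFin)
open import Data.List.Relation.Unary.Unique.Propositional using (Unique)
open import Data.Product using (Σ; _×_; _,_)
open import Relation.Binary.PropositionalEquality using (_≡_; _≢_)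

-- A directed multigraph on the vertex set Fin V: edges are indexed by Fin m,
-- each edge e goes from tail e to head e (parallel edges and loops allowed).
record Digraph (V : ℕ) : Set where
  field
    m    : ℕ
    tail : Fin m → Fin V
    head : Fin m → Fin V

module _ {V : ℕ} (G : Digraph V) where
  open Digraph G

  outdeg : Fin V → ℕ
  outdeg v = length (filter (λ e → tail e ≟ v) (allFin m))

  indeg : Fin V → ℕ
  indeg v = length (filter (λ e → head e ≟ v) (allFin m))

  -- degree counted with multiplicity (a loop contributes 2)
  degree : Fin V → ℕ
  degree v = outdeg v + indeg v

  ThreeRegular : Set
  ThreeRegular = ∀ v → degree v ≡ 3

  data Walk : Fin V → Fin V → List (Fin m) → Set where
    nil  : ∀ {u} → Walk u u []
    cons : ∀ {u v e es} → tail e ≡ u → Walk (head e) v es → Walk u v (e ∷ es)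

  Path : Fin V → Fin V → List (Fin m) → Set
  Path u v es = Walk u v es × Unique (u ∷ map head es)

  Acyclic : Set
  Acyclic = ∀ v es → Walk v v es → es ≡ []

  data UReach (ok : Fin m → Set) : Fin V → Fin V → Set where
    here : ∀ {u} → UReach ok u u
    fwd  : ∀ {u v} e → ok e → tail e ≡ u → UReach ok (head e) v → UReach ok u v
    bwd  : ∀ {u v} e → ok e → head e ≡ u → UReach ok (tail e) v → UReach ok u v

  TwoEdgeConnected : Set
  TwoEdgeConnected = (∀ u v → UReach (λ _ → ⊤') u v)
                   × (∀ d u v → UReach (λ e → e ≢ d) u v)
    where open import Data.Unit renaming (⊤ to ⊤')

  IsSource : Fin V → Set
  IsSource v = ∀ e → head e ≢ v

  IsSink : Fin V → Set
  IsSink v = ∀ e → tail e ≢ v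

  IsUniqueSource : Fin V → Set
  IsUniqueSource s = IsSource s × (∀ v → IsSource v → v ≡ s)

  IsUniqueSink : Fin V → Set
  IsUniqueSink t = IsSink t × (∀ v → IsSink v → v ≡ t)

{-# OPTIONS --safe #-}
module Submission where

-- List the vertices other than the source s as t = v₁, v₂, … so that the out-neighbours of each vᵢ
-- come before it; then Uᵢ = {v₁, …, vᵢ} is closed under out-neighbours. An entry walk of U is an edge
-- from outside U into U followed by a walk to t, and every s–t path is an entry walk of the largest Uᵢ.
-- Dropping the first edge of an entry walk of Uᵢ when that edge ends at vᵢ yields an entry walk of Uᵢ₋₁,
-- injectively as long as all the walks entering vᵢ use the same in-edge. If vᵢ has in-degree 1 the
-- bound is inherited; otherwise vᵢ has in-degree 2 and a single out-edge d, the walks entering through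
-- the second in-edge are mapped to walks starting with d, and since d is not a bridge some other edge
-- enters Uᵢ₋₁, giving an entry walk outside that image. So Uᵢ has at most 2 ^ k + 1 entry walks, where
-- k + 1 + |Uᵢ| is the sum of the in-degrees over Uᵢ, and counting degrees gives k = n for the largest Uᵢ.
-- Equality holds for the chain of 2-cycles 0 ⇉ 1 → 2 ⇉ 3 → ⋯ → 2n−2 ⇉ 2n−1 closed by an edge
-- 0 → 2n−1.

open import Defs
open import Data.Bool using (true; false; if_then_else_)
open import Data.Empty using (⊥; ⊥-elim)
open import Data.Fin using (Fin; _≟_; toℕ; fromℕ) renaming (zero to fz; suc to fs)
open import Data.Fin.Properties using (any?; toℕ-fromℕ; toℕ≤pred[n]) renaming (suc-injective to fs-injective)
open import Data.List using (List; []; _∷_; [_]; _++_; map; length; filter; allFin; tabulate)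
open import Data.List.Properties
  using (≡-dec; ∷-injectiveʳ; length-map; length-++; length-tabulate; map-injective;
         filter-all; filter-none; filter-some; filter-notAll; length-filter)
open import Data.List.Membership.Propositional using (_∈_; _∉_)
open import Data.List.Membership.Propositional.Properties
  using (∈-length; ∈-map⁺; ∈-map⁻; ∈-++⁺ˡ; ∈-++⁺ʳ; ∈-filter⁺; ∈-filter⁻; ∈-allFin)
import Data.List.Membership.DecPropositional as DecMembership
open import Data.List.Relation.Unary.All as All using (All; []; _∷_)
import Data.List.Relation.Unary.All.Properties as All
open import Data.List.Relation.Unary.All.Properties using (¬Any⇒All¬)
import Data.List.Relation.Unary.Any as Any
open import Data.List.Relation.Unary.Any using (here; there)
open import Data.List.Relation.Unary.Unique.Propositional using (Unique; []; _∷_)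
import Data.List.Relation.Unary.Unique.Propositional.Properties as Unique
open import Data.Nat using (ℕ; zero; suc; _+_; _*_; _^_; _∸_; _≤_; _<_; z≤n; s≤s; s≤s⁻¹)
open import Data.Nat.Induction using (<-wellFounded)
open import Data.Nat.ListAction using (sum)
open import Data.Nat.Properties
  using (+-suc; +-assoc; +-comm; +-identityʳ; *-suc; suc-injective; +-cancelˡ-≡; +-cancelʳ-≡; *-cancelˡ-≡;
         ≤-refl; ≤-trans; ≤-antisym; <⇒≤; <-irrefl; <-trans; <-≤-trans; n≮0; 1+n≰n; n≤1+n; n<1+n;
         +-mono-≤; ∸-monoʳ-<; +-commutativeSemigroup; module ≤-Reasoning)
open import Algebra.Properties.CommutativeSemigroup +-commutativeSemigroup using (interchange)
open import Data.Nat.Solver using (module +-*-Solver)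
open import Data.Product using (Σ; ∃; ∃₂; _×_; _,_; proj₁; proj₂)
open import Data.Sum using (_⊎_; inj₁; inj₂; [_,_]′)
open import Data.Unit using (⊤; tt)
open import Function using (id; _∘_)
open import Induction.WellFounded using (Acc; acc)
open import Relation.Binary using (DecidableEquality)
open import Relation.Binary.PropositionalEquality
  using (_≡_; _≢_; refl; sym; trans; cong; cong₂; subst; module ≡-Reasoning)
open import Relation.Nullary using (¬_; yes; no; does; ¬?; _×-dec_)
open import Relation.Unary using (Decidable)
open import Relation.Unary.Properties using (∁?)

-- Counting in lists

module _ {A : Set} where

  length-filter-∪ : {P Q R : A → Set} (P? : Decidable P) (Q? : Decidable Q) (R? : Decidable R) →
                    (∀ {x} → P x → ¬ Q x) →
                    (∀ {x} → R x → P x ⊎ Q x) → (∀ {x} → P x ⊎ Q x → R x) →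
                    ∀ xs → length (filter R? xs) ≡ length (filter P? xs) + length (filter Q? xs)
  length-filter-∪ P? Q? R? disjoint split join [] = refl
  length-filter-∪ P? Q? R? disjoint split join (x ∷ xs)
    with R? x | P? x | Q? x | length-filter-∪ P? Q? R? disjoint split join xs
  ... | yes _ | yes p | yes q | _  = ⊥-elim (disjoint p q)
  ... | yes _ | yes _ | no _  | ih = cong suc ih
  ... | yes _ | no _  | yes _ | ih = trans (cong suc ih) (sym (+-suc _ _))
  ... | yes r | no ¬p | no ¬q | _  = ⊥-elim ([ ¬p , ¬q ]′ (split r))
  ... | no ¬r | yes p | _     | _  = ⊥-elim (¬r (join (inj₁ p)))
  ... | no ¬r | no _  | yes q | _  = ⊥-elim (¬r (join (inj₂ q)))
  ... | no _  | no _  | no _  | ih = ih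

  length-filter-split : {P : A → Set} (P? : Decidable P) →
                        ∀ xs → length xs ≡ length (filter P? xs) + length (filter (∁? P?) xs)
  length-filter-split P? [] = refl
  length-filter-split P? (x ∷ xs) with P? x | length-filter-split P? xs
  ... | yes _ | ih = cong suc ih
  ... | no _  | ih = trans (cong suc ih) (sym (+-suc _ _))

  length≤sum-map : (g : A → ℕ) → ∀ {xs} → (∀ {x} → x ∈ xs → 1 ≤ g x) → length xs ≤ sum (map g xs)
  length≤sum-map g {[]}     pos = z≤n
  length≤sum-map g {x ∷ xs} pos = +-mono-≤ (pos (here refl)) (length≤sum-map g (pos ∘ there))

  Unique-map⁺-injectiveOn : {B : Set} {P : A → Set} (f : A → B) →
                            (∀ {x y} → P x → P y → f x ≡ f y → x ≡ y) →
                            ∀ {xs} → All P xs → Unique xs → Unique (map f xs)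
  Unique-map⁺-injectiveOn f inj [] [] = []
  Unique-map⁺-injectiveOn f inj (px ∷ pxs) (x∉ ∷ u) =
    All.map⁺ (All.zipWith (λ (py , x≢y) fx≡fy → x≢y (inj px py fx≡fy)) (pxs , x∉))
    ∷ Unique-map⁺-injectiveOn f inj pxs u

  sole-member : ∀ {xs : List A} → length xs ≡ 1 → ∃ λ x → ∀ {y} → y ∈ xs → y ≡ x
  sole-member {x ∷ []} _ = x , λ { (here y≡x) → y≡x }

  two-members : ∀ {xs : List A} → length xs ≡ 2 →
                ∃₂ λ x x′ → x′ ∈ xs × (∀ {y} → y ∈ xs → y ≡ x ⊎ y ≡ x′)
  two-members {x ∷ x′ ∷ []} _ =
    x , x′ , there (here refl) , λ { (here y≡x) → inj₁ y≡x ; (there (here y≡x′)) → inj₂ y≡x′ }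

  ∈-∷⁻ : ∀ {x y} {ys : List A} → x ∈ y ∷ ys → x ≢ y → x ∈ ys
  ∈-∷⁻ (here x≡y)   x≢y = ⊥-elim (x≢y x≡y)
  ∈-∷⁻ (there x∈ys) _   = x∈ys

module _ {A B : Set} (_≟ᴮ_ : DecidableEquality B) (f : A → B) where
  open DecMembership _≟ᴮ_ using (_∈?_)

  fibre-size : List A → B → ℕ
  fibre-size xs b = length (filter (λ x → f x ≟ᴮ b) xs)

  sum-fibre-sizes : ∀ xs {bs} → Unique bs →
                    sum (map (fibre-size xs) bs) ≡ length (filter (λ x → f x ∈? bs) xs)
  sum-fibre-sizes xs [] = sym (cong length (filter-none _ (All.universal (λ _ ()) xs)))
  sum-fibre-sizes xs {b ∷ bs} (b∉bs ∷ u) = begin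
    fibre-size xs b + sum (map (fibre-size xs) bs)
      ≡⟨ cong (fibre-size xs b +_) (sum-fibre-sizes xs u) ⟩
    fibre-size xs b + length (filter (λ x → f x ∈? bs) xs)
      ≡⟨ sym (length-filter-∪ (λ x → f x ≟ᴮ b) (λ x → f x ∈? bs) (λ x → f x ∈? b ∷ bs)
                              disjoint split join xs) ⟩
    length (filter (λ x → f x ∈? b ∷ bs) xs) ∎
    where
    open ≡-Reasoning
    disjoint : ∀ {x} → f x ≡ b → f x ∉ bs
    disjoint refl b∈bs = All.lookup b∉bs b∈bs refl
    split : ∀ {x} → f x ∈ b ∷ bs → f x ≡ b ⊎ f x ∈ bs
    split (here fx≡b)   = inj₁ fx≡b
    split (there fx∈bs) = inj₂ fx∈bs
    join : ∀ {x} → f x ≡ b ⊎ f x ∈ bs → f x ∈ b ∷ bs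
    join (inj₁ fx≡b)  = here fx≡b
    join (inj₂ fx∈bs) = there fx∈bs

module _ {A : Set} (_≟ᴬ_ : DecidableEquality A) where
  open DecMembership _≟ᴬ_ using (_∈?_)

  Unique∧⊆⇒length≤ : ∀ {xs ys} → Unique xs → (∀ {x} → x ∈ xs → x ∈ ys) → length xs ≤ length ys
  Unique∧⊆⇒length≤ {xs} {ys} u xs⊆ys = begin
    length xs                             ≤⟨ length≤sum-map (fibre-size _≟ᴬ_ id ys) occurs ⟩
    sum (map (fibre-size _≟ᴬ_ id ys) xs)  ≡⟨ sum-fibre-sizes _≟ᴬ_ id ys u ⟩
    length (filter (_∈? xs) ys)           ≤⟨ length-filter (_∈? xs) ys ⟩
    length ys                             ∎
    where
    open ≤-Reasoning
    occurs : ∀ {x} → x ∈ xs → 1 ≤ fibre-size _≟ᴬ_ id ys x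
    occurs x∈xs = filter-some (_≟ᴬ _) (Any.map sym (xs⊆ys x∈xs))

length-filter-tabulate : ∀ {A B : Set} {P : A → Set} {Q : B → Set} (P? : Decidable P) (Q? : Decidable Q) {n}
                         (f : Fin n → A) (g : Fin n → B) → (∀ i → does (P? (f i)) ≡ does (Q? (g i))) →
                         length (filter P? (tabulate f)) ≡ length (filter Q? (tabulate g))
length-filter-tabulate P? Q? {zero} f g same = refl
length-filter-tabulate P? Q? {suc n} f g same
  with does (P? (f fz)) | does (Q? (g fz)) | same fz | length-filter-tabulate P? Q? (f ∘ fs) (g ∘ fs) (same ∘ fs)
... | true  | true  | _  | ih = cong suc ih
... | false | false | _  | ih = ih
... | true  | false | () | _
... | false | true  | () | _

length-filter-tabulate-none : ∀ {A : Set} {P : A → Set} (P? : Decidable P) {n} (f : Fin n → A) →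
                              (∀ i → ¬ P (f i)) → length (filter P? (tabulate f)) ≡ 0
length-filter-tabulate-none P? f none = cong length (filter-none P? (All.tabulate⁺ none))

-- Walks, edges and reachability

infixr 5 _++ʷ_
_++ʷ_ : ∀ {V} {D : Digraph V} {u v w es fs} → Walk D u v es → Walk D v w fs → Walk D u w (es ++ fs)
nil       ++ʷ q = q
cons eq p ++ʷ q = cons eq (p ++ʷ q)

module _ {V : ℕ} (D : Digraph V) where
  open Digraph D

  first-step : ∀ {u w es} → Walk D u w es → u ≢ w →
               ∃₂ λ d ds → es ≡ d ∷ ds × tail d ≡ u × Walk D (head d) w ds
  first-step nil         u≢w = ⊥-elim (u≢w refl)
  first-step (cons td w) _   = _ , _ , refl , td , w

  walk-starts : ∀ {u w d ds} → Walk D u w (d ∷ ds) → tail d ≡ u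
  walk-starts (cons td _) = td

  walk-into-source : ∀ {s u es} → IsSource D s → Walk D u s es → u ≡ s
  walk-into-source src nil                = refl
  walk-into-source src (cons {e = e} _ w) = ⊥-elim (src e (walk-into-source src w))

  walk-from-sink : ∀ {t v es} → IsSink D t → Walk D t v es → es ≡ []
  walk-from-sink snk nil                  = refl
  walk-from-sink snk (cons {e = e} te _) = ⊥-elim (snk e te)

  Acyclic⇒≢ : Acyclic D → ∀ {u v e es} → Walk D u v (e ∷ es) → u ≢ v
  Acyclic⇒≢ acyclic w refl with () ← acyclic _ _ w

  inEdges outEdges : Fin V → List (Fin m)
  inEdges v  = filter (λ e → head e ≟ v) (allFin m)
  outEdges v = filter (λ e → tail e ≟ v) (allFin m)

  inEdges-∋ : ∀ {e v} → head e ≡ v → e ∈ inEdges v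
  inEdges-∋ = ∈-filter⁺ _ (∈-allFin _)

  outEdges-∋ : ∀ {e v} → tail e ≡ v → e ∈ outEdges v
  outEdges-∋ = ∈-filter⁺ _ (∈-allFin _)

  in-edge : ∀ {s v} → IsUniqueSource D s → v ≢ s → ∃ λ e → head e ≡ v
  in-edge {v = v} (_ , unique) v≢s with any? (λ e → head e ≟ v)
  ... | yes found = found
  ... | no none   = ⊥-elim (v≢s (unique v (λ e he → none (e , he))))

  out-edge : ∀ {t v} → IsUniqueSink D t → v ≢ t → ∃ λ e → tail e ≡ v
  out-edge {v = v} (_ , unique) v≢t with any? (λ e → tail e ≟ v)
  ... | yes found = found
  ... | no none   = ⊥-elim (v≢t (unique v (λ e te → none (e , te))))

  sole-edge : (f : Fin m → Fin V) → ∀ {v} → length (filter (λ e → f e ≟ v) (allFin m)) ≡ 1 →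
              ∃ λ e₀ → ∀ e → f e ≡ v → e ≡ e₀
  sole-edge f deg with sole-member deg
  ... | e₀ , only = e₀ , λ e fe≡v → only (∈-filter⁺ _ (∈-allFin e) fe≡v)

  two-in-edges : ∀ {v} → indeg D v ≡ 2 →
                 ∃₂ λ e₁ e₂ → head e₂ ≡ v × (∀ e → head e ≡ v → e ≡ e₁ ⊎ e ≡ e₂)
  two-in-edges deg with two-members deg
  ... | e₁ , e₂ , e₂∈ , only =
    e₁ , e₂ , proj₂ (∈-filter⁻ _ {xs = allFin m} e₂∈) , λ e he → only (inEdges-∋ he)

  source-by-in-edges : ∀ {s} → IsSource D s → (∀ v → v ≢ s → ∃ λ e → head e ≡ v) →
                       IsUniqueSource D s
  source-by-in-edges {s} src ins = src , unique
    where
    unique : ∀ v → IsSource D v → v ≡ s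
    unique v v-source with v ≟ s
    ... | yes v≡s = v≡s
    ... | no v≢s  = ⊥-elim (v-source _ (proj₂ (ins v v≢s)))

  sink-by-out-edges : ∀ {t} → IsSink D t → (∀ v → v ≢ t → ∃ λ e → tail e ≡ v) →
                      IsUniqueSink D t
  sink-by-out-edges {t} snk outs = snk , unique
    where
    unique : ∀ v → IsSink D v → v ≡ t
    unique v v-sink with v ≟ t
    ... | yes v≡t = v≡t
    ... | no v≢t  = ⊥-elim (v-sink _ (proj₂ (outs v v≢t)))

  UReach-trans : ∀ {ok u v w} → UReach D ok u v → UReach D ok v w → UReach D ok u w
  UReach-trans here             q = q
  UReach-trans (fwd e ok te r) q = fwd e ok te (UReach-trans r q)
  UReach-trans (bwd e ok he r) q = bwd e ok he (UReach-trans r q)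

  UReach-sym : ∀ {ok u v} → UReach D ok u v → UReach D ok v u
  UReach-sym here              = here
  UReach-sym (fwd e ok refl r) = UReach-trans (UReach-sym r) (bwd e ok refl here)
  UReach-sym (bwd e ok refl r) = UReach-trans (UReach-sym r) (fwd e ok refl here)

  UpClosed : List (Fin V) → Set
  UpClosed U = ∀ e → tail e ∈ U → head e ∈ U

  entering-edge : ∀ {ok U u x} → UpClosed U → UReach D ok u x → u ∈ U → x ∉ U →
                  ∃ λ e → ok e × tail e ∉ U × head e ∈ U
  entering-edge up here             u∈U x∉U = ⊥-elim (x∉U u∈U)
  entering-edge up (fwd e _ refl r) u∈U x∉U = entering-edge up r (up e u∈U) x∉U
  entering-edge {U = U} up (bwd e ok refl r) u∈U x∉U with tail e ∈? U
    where open DecMembership (_≟_ {V}) using (_∈?_)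
  ... | yes t∈U = entering-edge up r t∈U x∉U
  ... | no t∉U  = e , ok , t∉U , u∈U

  Ranked : Set
  Ranked = ∀ e → toℕ (tail e) < toℕ (head e)

  module _ (ranked : Ranked) where

    walk-rank : ∀ {u v es} → Walk D u v es → toℕ u ≤ toℕ v
    walk-rank nil                   = ≤-refl
    walk-rank (cons {e = e} refl w) = ≤-trans (<⇒≤ (ranked e)) (walk-rank w)

    Ranked⇒Acyclic : Acyclic D
    Ranked⇒Acyclic v []       w             = refl
    Ranked⇒Acyclic v (e ∷ es) (cons refl w) = ⊥-elim (<-irrefl refl (<-≤-trans (ranked e) (walk-rank w)))

    walk-heads-above : ∀ {u v es} → Walk D u v es → All (λ x → toℕ u < toℕ x) (map head es)
    walk-heads-above nil                   = []
    walk-heads-above (cons {e = e} refl w) = ranked e ∷ All.map (<-trans (ranked e)) (walk-heads-above w)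

    walk⇒path : ∀ {u v es} → Walk D u v es → Path D u v es
    walk⇒path w = w , distinct w
      where
      distinct : ∀ {u v es} → Walk D u v es → Unique (u ∷ map head es)
      distinct nil           = [] ∷ []
      distinct (cons refl w) =
        All.map (λ u<x u≡x → <-irrefl (cong toℕ u≡x) u<x) (walk-heads-above (cons refl w)) ∷ distinct w

module _ {n : ℕ} (D : Digraph (suc n)) (ranked : Ranked D) where
  open Digraph D

  ranked-source : IsSource D fz
  ranked-source e he = n≮0 (subst (λ x → toℕ (tail e) < toℕ x) he (ranked e))

  ranked-sink : IsSink D (fromℕ n)
  ranked-sink e te = <-irrefl refl (<-≤-trans n<head (toℕ≤pred[n] (head e)))
    where
    n<head : n < toℕ (head e)
    n<head = subst (_< toℕ (head e)) (trans (cong toℕ te) (toℕ-fromℕ n)) (ranked e)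

record Hom {V W : ℕ} (G : Digraph V) (H : Digraph W) : Set where
  field
    vertex    : Fin V → Fin W
    edge      : Fin (Digraph.m G) → Fin (Digraph.m H)
    tail-edge : ∀ e → Digraph.tail H (edge e) ≡ vertex (Digraph.tail G e)
    head-edge : ∀ e → Digraph.head H (edge e) ≡ vertex (Digraph.head G e)

  Walk-map : ∀ {u v es} → Walk G u v es → Walk H (vertex u) (vertex v) (map edge es)
  Walk-map nil                   = nil
  Walk-map (cons {e = e} refl w) = cons (tail-edge e) (subst (λ x → Walk H x _ _) (sym (head-edge e)) (Walk-map w))

  UReach-map : ∀ {ok ok′ u v} → (∀ e → ok e → ok′ (edge e)) →
               UReach G ok u v → UReach H ok′ (vertex u) (vertex v)
  UReach-map keep here = here
  UReach-map keep (fwd e ok refl r) =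
    fwd (edge e) (keep e ok) (tail-edge e) (subst (λ x → UReach H _ x _) (sym (head-edge e)) (UReach-map keep r))
  UReach-map keep (bwd e ok refl r) =
    bwd (edge e) (keep e ok) (head-edge e) (subst (λ x → UReach H _ x _) (sym (tail-edge e)) (UReach-map keep r))

-- Topological orders of up-sets

module _ {V : ℕ} (D : Digraph V) where
  open Digraph D
  open DecMembership (_≟_ {V}) using (_∈?_)

  data TopSorted (t : Fin V) : List (Fin V) → Set where
    base : TopSorted t [ t ]
    grow : ∀ {v us} → v ∉ us → (∀ e → tail e ≡ v → head e ∈ us) → TopSorted t us →
           TopSorted t (v ∷ us)

  module _ {t : Fin V} where

    TopSorted-∋ : ∀ {us} → TopSorted t us → t ∈ us
    TopSorted-∋ base              = here refl
    TopSorted-∋ (grow _ _ sorted) = there (TopSorted-∋ sorted)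

    TopSorted-unique : ∀ {us} → TopSorted t us → Unique us
    TopSorted-unique base                           = [] ∷ []
    TopSorted-unique (grow {us = us} v∉us _ sorted) = ¬Any⇒All¬ us v∉us ∷ TopSorted-unique sorted

    TopSorted-upClosed : IsSink D t → ∀ {us} → TopSorted t us → UpClosed D us
    TopSorted-upClosed snk base              e (here te)  = ⊥-elim (snk e te)
    TopSorted-upClosed snk (grow _ into _)   e (here te)  = there (into e te)
    TopSorted-upClosed snk (grow _ _ sorted) e (there t∈) = there (TopSorted-upClosed snk sorted e t∈)

    TopSorted-reach : IsUniqueSink D t → ∀ {us u} → TopSorted t us → u ∈ us → ∃ (Walk D u t)
    TopSorted-reach snk base (here refl) = [] , nil
    TopSorted-reach snk (grow v∉us into sorted) (here refl)
      with out-edge D snk (λ { refl → v∉us (TopSorted-∋ sorted) })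
    ... | e , te with TopSorted-reach snk sorted (into e te)
    ...   | es , w = e ∷ es , cons te w
    TopSorted-reach snk (grow _ _ sorted) (there u∈) = TopSorted-reach snk sorted u∈

  walk-to-maximal : Acyclic D → ∀ xs {x} → x ∈ xs →
                    ∃ λ y → y ∈ xs × ∃ (Walk D x y) × (∀ e → tail e ≡ y → head e ∉ xs)
  walk-to-maximal acyclic xs = go xs (<-wellFounded (length xs))
    where
    go : ∀ xs {x} → Acc _<_ (length xs) → x ∈ xs →
         ∃ λ y → y ∈ xs × ∃ (Walk D x y) × (∀ e → tail e ≡ y → head e ∉ xs)
    go xs {x} (acc rs) x∈xs with any? (λ e → (tail e ≟ x) ×-dec (head e ∈? xs))
    ... | no none = x , x∈xs , ([] , nil) , λ e te h∈ → none (e , te , h∈)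
    ... | yes (e , refl , h∈xs)
      with go others (rs shorter) (∈-filter⁺ _ h∈xs (Acyclic⇒≢ D acyclic (cons refl nil) ∘ sym))
      where
      others : List (Fin V)
      others = filter (λ z → ¬? (z ≟ tail e)) xs
      shorter : length others < length xs
      shorter = filter-notAll _ xs (Any.map (λ x≡z z≢x → z≢x (sym x≡z)) x∈xs)
    ... | y , y∈ , (es , w) , stuck = y , proj₁ (∈-filter⁻ _ y∈) , (e ∷ es , cons refl w) , maximal
      where
      -- Discarding x from the candidates is harmless: an edge from y back to x would close a cycle.
      maximal : ∀ d → tail d ≡ y → head d ∉ xs
      maximal d td h∈xs with head d ≟ tail e
      ... | yes back = Acyclic⇒≢ D acyclic (cons refl w ++ʷ cons td nil) (sym back)
      ... | no h≢x   = stuck d td (∈-filter⁺ _ h∈xs h≢x)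

  topSort : Acyclic D → ∀ {s t} → IsSource D s → s ≢ t →
            ∃ λ us → TopSorted t us × s ∉ us × (∀ v → v ≢ s → v ∈ us)
  topSort acyclic {s} {t} src s≢t = extend (<-wellFounded _) base λ { (here s≡t) → s≢t s≡t }
    where
    missing : List (Fin V) → List (Fin V)
    missing us = filter (λ v → ¬? (v ∈? us)) (allFin V)
    extend : ∀ {us} → Acc _<_ (V ∸ length us) → TopSorted t us → s ∉ us →
             ∃ λ us → TopSorted t us × s ∉ us × (∀ v → v ≢ s → v ∈ us)
    extend {us} (acc rs) sorted s∉us with any? (λ v → ¬? (v ≟ s) ×-dec ¬? (v ∈? us))
    ... | no none = us , sorted , s∉us , covered
      where
      covered : ∀ v → v ≢ s → v ∈ us
      covered v v≢s with v ∈? us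
      ... | yes v∈us = v∈us
      ... | no v∉us  = ⊥-elim (none (v , v≢s , v∉us))
    ... | yes (x , x≢s , x∉us) with walk-to-maximal acyclic (missing us) (∈-filter⁺ _ (∈-allFin x) x∉us)
    ... | y , y∈ , (_ , x⇝y) , maximal = extend (rs shrinks) sorted′ s∉
      where
      into : ∀ e → tail e ≡ y → head e ∈ us
      into e te with head e ∈? us
      ... | yes h∈us = h∈us
      ... | no h∉us  = ⊥-elim (maximal e te (∈-filter⁺ _ (∈-allFin _) h∉us))
      sorted′ : TopSorted t (y ∷ us)
      sorted′ = grow (proj₂ (∈-filter⁻ (λ v → ¬? (v ∈? us)) {xs = allFin V} y∈)) into sorted
      s∉ : s ∉ y ∷ us
      s∉ (here refl)  = x≢s (walk-into-source D src x⇝y)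
      s∉ (there s∈us) = s∉us s∈us
      shrinks : V ∸ length (y ∷ us) < V ∸ length us
      shrinks = ∸-monoʳ-< (n<1+n _) (subst (length (y ∷ us) ≤_) (length-tabulate id)
                  (Unique∧⊆⇒length≤ _≟_ (TopSorted-unique sorted′) (λ _ → ∈-allFin _)))

-- Entry walks and the upper bound

module _ {V : ℕ} (D : Digraph V) where
  open Digraph D

  FirstEdge : (Fin m → Set) → List (Fin m) → Set
  FirstEdge P []      = ⊥
  FirstEdge P (e ∷ _) = P e

  firstEdge? : ∀ {P} → Decidable P → Decidable (FirstEdge P)
  firstEdge? P? []      = no λ ()
  firstEdge? P? (e ∷ _) = P? e

  data EntryWalk (t : Fin V) (U : List (Fin V)) : List (Fin m) → Set where
    entry : ∀ {e r} → tail e ∉ U → head e ∈ U → Walk D (head e) t r → EntryWalk t U (e ∷ r)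

  strip : Fin V → List (Fin m) → List (Fin m)
  strip v [] = []
  strip v (e ∷ r) with head e ≟ v
  ... | yes _ = r
  ... | no _  = e ∷ r

excess-arithmetic : ∀ {n a i o m} → suc a ≡ 2 * n → i ≡ m → 3 + o ≡ m → o + i ≡ 3 * a → suc n + a ≡ i
excess-arithmetic {n} {a} {i} {o} {m} a+1≡2n i≡m 3+o≡m o+i≡3a = *-cancelˡ-≡ (suc n + a) i 2 (begin
  2 * (suc n + a)   ≡⟨ solve 2 (λ n a → con 2 :* (con 1 :+ n :+ a) := con 2 :+ con 2 :* n :+ con 2 :* a) refl n a ⟩
  2 + 2 * n + 2 * a ≡⟨ cong (λ x → 2 + x + 2 * a) (sym a+1≡2n) ⟩
  2 + suc a + 2 * a ≡⟨ solve 1 (λ a → con 2 :+ (con 1 :+ a) :+ con 2 :* a := con 3 :+ con 3 :* a) refl a ⟩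
  3 + 3 * a         ≡⟨ cong (3 +_) (sym o+i≡3a) ⟩
  3 + (o + i)       ≡⟨ sym (+-assoc 3 o i) ⟩
  3 + o + i         ≡⟨ cong (_+ i) (trans 3+o≡m (sym i≡m)) ⟩
  i + i             ≡⟨ cong (i +_) (sym (+-identityʳ i)) ⟩
  2 * i             ∎)
  where open ≡-Reasoning
        open +-*-Solver

excess-step : ∀ i k a σ → suc (i + k) + suc a ≡ suc i + σ → suc k + a ≡ σ
excess-step i k a σ eq =
  trans (sym (+-suc k a)) (+-cancelˡ-≡ i _ _ (trans (sym (+-assoc i k (suc a))) (suc-injective eq)))

module UpperBound {V : ℕ} (D : Digraph V) (regular : ThreeRegular D) (2ec : TwoEdgeConnected D)
                  {s t : Fin V} (source : IsUniqueSource D s) (sink : IsUniqueSink D t) where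
  open Digraph D

  EntriesAtMost : List (Fin V) → ℕ → Set
  EntriesAtMost U n = ∀ {L} → Unique L → All (EntryWalk D t U) L → length L ≤ n

  Σin Σout : List (Fin V) → ℕ
  Σin us  = sum (map (indeg D) us)
  Σout us = sum (map (outdeg D) us)

  indeg-t : indeg D t ≡ 3
  indeg-t = trans (cong (λ es → length es + indeg D t) (sym no-out-edges)) (regular t)
    where
    no-out-edges : outEdges D t ≡ []
    no-out-edges = filter-none (λ e → tail e ≟ t) (All.universal (proj₁ sink) (allFin m))

  indeg-s : indeg D s ≡ 0
  indeg-s = cong length (filter-none (λ e → head e ≟ s) (All.universal (proj₁ source) (allFin m)))

  s≢t : s ≢ t
  s≢t refl with () ← trans (sym indeg-s) indeg-t

  degree-split : ∀ {o i} → o + i ≡ 3 → 0 < o → 0 < i → i ≡ 1 ⊎ (i ≡ 2 × o ≡ 1)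
  degree-split {1} refl _ _  = inj₂ (refl , refl)
  degree-split {2} refl _ _  = inj₁ refl
  degree-split {3} refl _ ()

  inner-degree : ∀ {v} → v ≢ s → v ≢ t → indeg D v ≡ 1 ⊎ (indeg D v ≡ 2 × outdeg D v ≡ 1)
  inner-degree v≢s v≢t = degree-split (regular _) (∈-length (outEdges-∋ D (proj₂ (out-edge D sink v≢t))))
                                                  (∈-length (inEdges-∋ D (proj₂ (in-edge D source v≢s))))

  entries-into-sink : ∀ k → suc k + 1 ≡ Σin [ t ] → EntriesAtMost [ t ] (2 ^ k + 1)
  entries-into-sink k eq {L} uL aL =
    subst (length L ≤_) bound (Unique∧⊆⇒length≤ (≡-dec _≟_) uL (single-edge ∘ All.lookup aL))
    where
    single-edge : ∀ {w} → EntryWalk D t [ t ] w → w ∈ map [_] (inEdges D t)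
    single-edge (entry _ (here he) walk) with walk-from-sink D (proj₁ sink) (subst (λ u → Walk D u t _) he walk)
    ... | refl = ∈-map⁺ [_] (inEdges-∋ D he)
    k≡1 : k ≡ 1
    k≡1 = +-cancelʳ-≡ 1 k 1 (suc-injective (trans eq (trans (+-identityʳ _) indeg-t)))
    bound : length (map [_] (inEdges D t)) ≡ 2 ^ k + 1
    bound rewrite k≡1 = trans (length-map [_] (inEdges D t)) indeg-t

  Σin-lower : ∀ {us} → TopSorted D t us → s ∉ us → 2 + length us ≤ Σin us
  Σin-lower base _ = subst (3 ≤_) (sym (trans (+-identityʳ _) indeg-t)) ≤-refl
  Σin-lower (grow v∉us _ sorted) s∉ =
    +-mono-≤ (∈-length (inEdges-∋ D (proj₂ (in-edge D source (λ v≡s → s∉ (here (sym v≡s)))))))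
             (Σin-lower sorted (s∉ ∘ there))

  module Grow {v us} (v∉us : v ∉ us) (into : ∀ e → tail e ≡ v → head e ∈ us) (v≢t : v ≢ t) where

    Enters Leaves : List (Fin m) → Set
    Enters = FirstEdge D (λ e → head e ≡ v)
    Leaves = FirstEdge D (λ e → tail e ≡ v)

    EntersVia : Fin m → List (Fin m) → Set
    EntersVia e₀ = FirstEdge D (λ e → head e ≡ v → e ≡ e₀)

    strip-entry : ∀ {w} → EntryWalk D t (v ∷ us) w → EntryWalk D t us (strip D v w)
    strip-entry (entry {e} t∉ h∈ walk) with head e ≟ v
    ... | no h≢v  = entry (t∉ ∘ there) (∈-∷⁻ h∈ h≢v) walk
    ... | yes h≡v with first-step D walk (λ h≡t → v≢t (trans (sym h≡v) h≡t))
    ...   | d , _ , refl , td , walk′ =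
            entry (λ d∈us → v∉us (subst (_∈ us) (trans td h≡v) d∈us)) (into d (trans td h≡v)) walk′

    strip-injective : ∀ {e₀ w₁ w₂} → EntryWalk D t (v ∷ us) w₁ → EntryWalk D t (v ∷ us) w₂ →
                      EntersVia e₀ w₁ → EntersVia e₀ w₂ → strip D v w₁ ≡ strip D v w₂ → w₁ ≡ w₂
    strip-injective (entry {e₁} t∉₁ _ walk₁) (entry {e₂} t∉₂ _ walk₂) via₁ via₂ eq
      with head e₁ ≟ v | head e₂ ≟ v
    ... | yes h₁ | yes h₂ = cong₂ _∷_ (trans (via₁ h₁) (sym (via₂ h₂))) eq
    ... | no _   | no _   = eq
    ... | yes h₁ | no _   = ⊥-elim (t∉₂ (here (trans (walk-starts D (subst (Walk D _ t) eq walk₁)) h₁)))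
    ... | no _   | yes h₂ = ⊥-elim (t∉₁ (here (trans (walk-starts D (subst (Walk D _ t) (sym eq) walk₂)) h₂)))

    strip-leaves : ∀ {w} → EntryWalk D t (v ∷ us) w → Enters w → Leaves (strip D v w)
    strip-leaves (entry {e} _ _ walk) h≡v with head e ≟ v
    ... | no h≢v = ⊥-elim (h≢v h≡v)
    ... | yes _ with first-step D walk (λ h≡t → v≢t (trans (sym h≡v) h≡t))
    ...   | d , _ , refl , td , _ = trans td h≡v

    strip-all : ∀ {e₀ L} → Unique L → All (EntryWalk D t (v ∷ us)) L → All (EntersVia e₀) L →
                Unique (map (strip D v) L) × All (EntryWalk D t us) (map (strip D v) L)
    strip-all uL aL vL =
      Unique-map⁺-injectiveOn (strip D v)
        (λ (ew₁ , via₁) (ew₂ , via₂) → strip-injective ew₁ ew₂ via₁ via₂) (All.zip (aL , vL)) uL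
      , All.map⁺ (All.map strip-entry aL)

    entries-via : ∀ {e₀ n} → EntriesAtMost us n →
                  ∀ {L} → Unique L → All (EntryWalk D t (v ∷ us)) L → All (EntersVia e₀) L → length L ≤ n
    entries-via bound {L} uL aL vL with strip-all uL aL vL
    ... | uL′ , aL′ = subst (_≤ _) (length-map (strip D v) L) (bound uL′ aL′)

    -- Since d is not a bridge, some edge other than d enters us, and it does not leave v.
    extra-entry : ∀ {d} → (∀ e → tail e ≡ v → e ≡ d) → UpClosed D us → t ∈ us → s ∉ us →
                  (∀ {u} → u ∈ us → ∃ (Walk D u t)) →
                  ∃ λ w → EntryWalk D t us w × ¬ Leaves w
    extra-entry {d} out up t∈us s∉us reach with entering-edge D up (proj₂ 2ec d t s) t∈us s∉us
    ... | e , e≢d , t∉ , h∈ with reach h∈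
    ...   | r , walk = e ∷ r , entry t∉ h∈ walk , λ te → e≢d (out e te)

    entries-starting-with : ∀ {e₀ n} → head e₀ ≡ v →
                            (∃ λ w → EntryWalk D t us w × ¬ Leaves w) → EntriesAtMost us n →
                            ∀ {L} → Unique L → All (EntryWalk D t (v ∷ us)) L → All (FirstEdge D (_≡ e₀)) L →
                            suc (length L) ≤ n
    entries-starting-with {e₀} {n} he₀ (w , ew , ¬leaves) bound {L} uL aL sL
      with strip-all {e₀} uL aL (All.map (λ {w} → via {w}) sL)
      where
      via : ∀ {w} → FirstEdge D (_≡ e₀) w → EntersVia e₀ w
      via {_ ∷ _} e≡e₀ _ = e≡e₀
    ... | uL′ , aL′ = subst (_≤ n) (cong suc (length-map (strip D v) L)) (bound (w∉ ∷ uL′) (ew ∷ aL′))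
      where
      enters : ∀ {w} → FirstEdge D (_≡ e₀) w → Enters w
      enters {_ ∷ _} refl = he₀
      w∉ : All (w ≢_) (map (strip D v) L)
      w∉ = All.map⁺ (All.zipWith (λ {w′} (ew′ , s′) w≡ →
                                    ¬leaves (subst Leaves (sym w≡) (strip-leaves ew′ (enters {w′} s′))))
                                 (aL , sL))

    grow-sole-in : ∀ {e₀ n} → (∀ e → head e ≡ v → e ≡ e₀) →
                   EntriesAtMost us n → EntriesAtMost (v ∷ us) n
    grow-sole-in only bound uL aL = entries-via bound uL aL (All.map (λ { (entry {e} _ _ _) → only e }) aL)

    grow-two-in : ∀ {e₁ e₂ d k} → head e₂ ≡ v → (∀ e → head e ≡ v → e ≡ e₁ ⊎ e ≡ e₂) →
                  (∀ e → tail e ≡ v → e ≡ d) →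
                  UpClosed D us → t ∈ us → s ∉ us → (∀ {u} → u ∈ us → ∃ (Walk D u t)) →
                  EntriesAtMost us (2 ^ k + 1) → EntriesAtMost (v ∷ us) (2 ^ suc k + 1)
    grow-two-in {e₁} {e₂} {d} {k} he₂ ins out up t∈us s∉us reach bound {L} uL aL = begin
      length L                 ≡⟨ length-filter-split via₂? L ⟩
      length L₂ + length Lᵣ    ≤⟨ +-mono-≤ bound₂ boundᵣ ⟩
      2 ^ k + (2 ^ k + 1)      ≡⟨ cong (λ x → 2 ^ k + (x + 1)) (sym (+-identityʳ (2 ^ k))) ⟩
      2 ^ k + (2 ^ k + 0 + 1)  ≡⟨ sym (+-assoc (2 ^ k) _ 1) ⟩
      2 ^ suc k + 1            ∎
      where
      open ≤-Reasoning
      via₂? : Decidable (FirstEdge D (_≡ e₂))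
      via₂? = firstEdge? D (_≟ e₂)
      L₂ Lᵣ : List (List (Fin m))
      L₂ = filter via₂? L
      Lᵣ = filter (∁? via₂?) L
      bound₂ : length L₂ ≤ 2 ^ k
      bound₂ = s≤s⁻¹ (subst (suc (length L₂) ≤_) (+-comm (2 ^ k) 1)
                 (entries-starting-with he₂ (extra-entry out up t∈us s∉us reach) bound
                                        (Unique.filter⁺ via₂? uL) (All.filter⁺ via₂? aL) (All.all-filter via₂? L)))
      via₁ : ∀ {w} → EntryWalk D t (v ∷ us) w → ¬ FirstEdge D (_≡ e₂) w → EntersVia e₁ w
      via₁ (entry {e} _ _ _) e≢e₂ he with ins e he
      ... | inj₁ e≡e₁ = e≡e₁
      ... | inj₂ e≡e₂ = ⊥-elim (e≢e₂ e≡e₂)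
      boundᵣ : length Lᵣ ≤ 2 ^ k + 1
      boundᵣ = entries-via bound (Unique.filter⁺ (∁? via₂?) uL) (All.filter⁺ (∁? via₂?) aL)
                 (All.zipWith (λ {w} (ew , ¬via₂) → via₁ {w} ew ¬via₂)
                              (All.filter⁺ (∁? via₂?) aL , All.all-filter (∁? via₂?) L))

    grow-bound : TopSorted D t us → s ∉ us → v ≢ s →
                 (∀ k → suc k + length us ≡ Σin us → EntriesAtMost us (2 ^ k + 1)) →
                 ∀ k → suc k + length (v ∷ us) ≡ Σin (v ∷ us) → EntriesAtMost (v ∷ us) (2 ^ k + 1)
    grow-bound sorted s∉us v≢s ih k eq with inner-degree v≢s v≢t
    ... | inj₁ in₁ =
      grow-sole-in (proj₂ (sole-edge D head in₁)) (ih k (excess-step 0 k _ _ (trans eq (cong (_+ Σin us) in₁))))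
    ... | inj₂ (in₂ , out₁) with k | two-in-edges D in₂ | trans eq (cong (_+ Σin us) in₂)
    ...   | zero | _ | eq₂ =
      ⊥-elim (1+n≰n (≤-trans (n≤1+n _) (subst (2 + length us ≤_) (sym (+-cancelˡ-≡ 2 _ _ eq₂))
                                                (Σin-lower sorted s∉us))))
    ...   | suc k | e₁ , e₂ , he₂ , ins | eq₂ =
      grow-two-in {k = k} he₂ ins (proj₂ (sole-edge D tail out₁)) (TopSorted-upClosed D (proj₁ sink) sorted)
                  (TopSorted-∋ D sorted) s∉us (TopSorted-reach D sink sorted) (ih k (excess-step 1 k _ _ eq₂))

  entries-bound : ∀ {us} → TopSorted D t us → s ∉ us → ∀ k → suc k + length us ≡ Σin us →
                  EntriesAtMost us (2 ^ k + 1)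
  entries-bound base _ = entries-into-sink
  entries-bound (grow {v} {us} v∉us into sorted) s∉ =
    Grow.grow-bound v∉us into v≢t sorted (s∉ ∘ there) (λ v≡s → s∉ (here (sym v≡s)))
                    (entries-bound sorted (s∉ ∘ there))
    where
    v≢t : v ≢ t
    v≢t v≡t = v∉us (subst (_∈ us) (sym v≡t) (TopSorted-∋ D sorted))

  Σ-degrees : ∀ us → Σout us + Σin us ≡ 3 * length us
  Σ-degrees []       = refl
  Σ-degrees (u ∷ us) = begin
    (outdeg D u + Σout us) + (indeg D u + Σin us) ≡⟨ interchange (outdeg D u) _ _ _ ⟩
    (outdeg D u + indeg D u) + (Σout us + Σin us) ≡⟨ cong₂ _+_ (regular u) (Σ-degrees us) ⟩
    3 + 3 * length us                              ≡⟨ sym (*-suc 3 (length us)) ⟩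
    3 * suc (length us)                            ∎
    where open ≡-Reasoning

  Σ-covering : (f : Fin m → Fin V) → ∀ {us} → Unique us → (∀ e → f e ∈ us) →
               sum (map (fibre-size _≟_ f (allFin m)) us) ≡ m
  Σ-covering f {us} uus covered = begin
    sum (map (fibre-size _≟_ f (allFin m)) us)   ≡⟨ sum-fibre-sizes _≟_ f (allFin m) uus ⟩
    length (filter (λ e → f e ∈? us) (allFin m))
      ≡⟨ cong length (filter-all _ (All.universal covered (allFin m))) ⟩
    length (allFin m)                            ≡⟨ length-tabulate id ⟩
    m                                            ∎
    where open ≡-Reasoning
          open DecMembership (_≟_ {V}) using (_∈?_)

  covering-excess : ∀ {n us} → V ≡ 2 * n → Unique us → s ∉ us → (∀ v → v ≢ s → v ∈ us) →
                    suc n + length us ≡ Σin us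
  covering-excess {n} {us} V≡2n uus s∉us covers = excess-arithmetic vertex-count Σin≡m Σout≡m (Σ-degrees us)
    where
    uss : Unique (s ∷ us)
    uss = ¬Any⇒All¬ us s∉us ∷ uus
    everywhere : ∀ v → v ∈ s ∷ us
    everywhere v with v ≟ s
    ... | yes v≡s = here v≡s
    ... | no v≢s  = there (covers v v≢s)
    vertex-count : suc (length us) ≡ 2 * n
    vertex-count = trans (≤-antisym
      (subst (suc (length us) ≤_) (length-tabulate id) (Unique∧⊆⇒length≤ _≟_ uss (λ _ → ∈-allFin _)))
      (subst (_≤ suc (length us)) (length-tabulate id)
             (Unique∧⊆⇒length≤ _≟_ (Unique.allFin⁺ V) (λ {v} _ → everywhere v))))
      V≡2n
    Σin≡m : Σin us ≡ m
    Σin≡m = Σ-covering head uus (λ e → covers (head e) (proj₁ source e))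
    outdeg-s : outdeg D s ≡ 3
    outdeg-s = trans (sym (+-identityʳ _)) (trans (cong (outdeg D s +_) (sym indeg-s)) (regular s))
    Σout≡m : 3 + Σout us ≡ m
    Σout≡m = trans (cong (_+ Σout us) (sym outdeg-s)) (Σ-covering tail uss (everywhere ∘ tail))

  path-entry : ∀ {us w} → s ∉ us → (∀ v → v ≢ s → v ∈ us) → Path D s t w → EntryWalk D t us w
  path-entry s∉us covers (walk , _) with first-step D walk s≢t
  ... | d , _ , refl , ts , walk′ =
    entry (λ t∈ → s∉us (subst (_∈ _) ts t∈)) (covers (head d) (proj₁ source d)) walk′

  paths-bound : Acyclic D → ∀ {n} → V ≡ 2 * n →
                ∀ {ps} → Unique ps → All (Path D s t) ps → length ps ≤ 2 ^ n + 1
  paths-bound acyclic {n} V≡2n ups aps with topSort D acyclic (proj₁ source) s≢t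
  ... | us , sorted , s∉us , covers =
    entries-bound sorted s∉us n (covering-excess V≡2n (TopSorted-unique D sorted) s∉us covers)
                  ups (All.map (path-entry s∉us covers) aps)

-- The extremal digraphs

fs-injective³ : ∀ {n} {i j : Fin n} → fs (fs (fs i)) ≡ fs (fs (fs j)) → i ≡ j
fs-injective³ = fs-injective ∘ fs-injective ∘ fs-injective

digon : Digraph 2
digon = record { m = 2 ; tail = λ _ → fz ; head = λ _ → fs fz }

module _ {V : ℕ} (G : Digraph (suc V)) where
  open Digraph G

  private
    shift : Fin m → Fin (3 + m)
    shift e = fs (fs (fs e))

  prepend : Digraph (3 + V)
  prepend = record { m = 3 + m ; tail = tail⁺ ; head = head⁺ }
    where
    tail⁺ head⁺ : Fin (3 + m) → Fin (3 + V)
    tail⁺ fz               = fz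
    tail⁺ (fs fz)          = fz
    tail⁺ (fs (fs fz))     = fs fz
    tail⁺ (fs (fs (fs e))) = fs (fs (tail e))
    head⁺ fz               = fs fz
    head⁺ (fs fz)          = fs fz
    head⁺ (fs (fs fz))     = fs (fs fz)
    head⁺ (fs (fs (fs e))) = fs (fs (head e))

  prepend-hom : Hom G prepend
  prepend-hom = record { vertex = fs ∘ fs ; edge = shift ; tail-edge = λ _ → refl ; head-edge = λ _ → refl }

  prepend-ranked : Ranked G → Ranked prepend
  prepend-ranked ranked fz               = s≤s z≤n
  prepend-ranked ranked (fs fz)          = s≤s z≤n
  prepend-ranked ranked (fs (fs fz))     = s≤s (s≤s z≤n)
  prepend-ranked ranked (fs (fs (fs e))) = s≤s (s≤s (ranked e))

  private
    tail⁺ head⁺ : Fin (3 + m) → Fin (3 + V)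
    tail⁺ = Digraph.tail prepend
    head⁺ = Digraph.head prepend

    shifted-none : (f : Fin (3 + m) → Fin (3 + V)) → ∀ v → (∀ e → f (shift e) ≢ v) →
                   length (filter (λ e → f e ≟ v) (tabulate shift)) ≡ 0
    shifted-none f v = length-filter-tabulate-none (λ e → f e ≟ v) shift

    shifted-outdeg : ∀ w → length (filter (λ e → tail⁺ e ≟ fs (fs w)) (tabulate shift)) ≡ outdeg G w
    shifted-outdeg w = length-filter-tabulate (λ e → tail⁺ e ≟ fs (fs w)) (λ e → tail e ≟ w) shift id
                                              λ _ → refl

    shifted-indeg : ∀ w → length (filter (λ e → head⁺ e ≟ fs (fs w)) (tabulate shift)) ≡ indeg G w
    shifted-indeg w = length-filter-tabulate (λ e → head⁺ e ≟ fs (fs w)) (λ e → head e ≟ w) shift id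
                                             λ _ → refl

  prepend-degree-0 : degree prepend fz ≡ 2
  prepend-degree-0 = cong₂ _+_ (cong (2 +_) (shifted-none tail⁺ fz λ _ ())) (shifted-none head⁺ fz λ _ ())

  prepend-degree-1 : degree prepend (fs fz) ≡ 3
  prepend-degree-1 =
    cong₂ _+_ (cong suc (shifted-none tail⁺ (fs fz) λ _ ())) (cong (2 +_) (shifted-none head⁺ (fs fz) λ _ ()))

  prepend-degree-2 : degree prepend (fs (fs fz)) ≡ suc (degree G fz)
  prepend-degree-2 = trans (cong₂ _+_ (shifted-outdeg fz) (cong suc (shifted-indeg fz))) (+-suc _ _)

  prepend-degree-shift : ∀ w → degree prepend (fs (fs (fs w))) ≡ degree G (fs w)
  prepend-degree-shift w = cong₂ _+_ (shifted-outdeg (fs w)) (shifted-indeg (fs w))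

  via : Fin (3 + m) → List (Fin m) → List (Fin (3 + m))
  via first w = first ∷ fs (fs fz) ∷ map shift w

  prependWalks : List (List (Fin m)) → List (List (Fin (3 + m)))
  prependWalks ws = map (via fz) ws ++ map (via (fs fz)) ws

  prependWalks-length : ∀ ws → length (prependWalks ws) ≡ 2 * length ws
  prependWalks-length ws = begin
    length (map (via fz) ws ++ map (via (fs fz)) ws)
      ≡⟨ length-++ (map (via fz) ws) ⟩
    length (map (via fz) ws) + length (map (via (fs fz)) ws)
      ≡⟨ cong₂ _+_ (length-map (via fz) ws) (length-map (via (fs fz)) ws) ⟩
    length ws + length ws
      ≡⟨ cong (length ws +_) (sym (+-identityʳ _)) ⟩
    2 * length ws ∎
    where open ≡-Reasoning

  prependWalks-unique : ∀ {ws} → Unique ws → Unique (prependWalks ws)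
  prependWalks-unique uws = Unique.++⁺ (Unique.map⁺ via-injective uws) (Unique.map⁺ via-injective uws) disjoint
    where
    via-injective : ∀ {first x y} → via first x ≡ via first y → x ≡ y
    via-injective eq = map-injective fs-injective³ (∷-injectiveʳ (∷-injectiveʳ eq))
    disjoint : ∀ {w} → ¬ (w ∈ map (via fz) _ × w ∈ map (via (fs fz)) _)
    disjoint (∈₀ , ∈₁) with ∈-map⁻ (via fz) ∈₀ | ∈-map⁻ (via (fs fz)) ∈₁
    ... | _ , _ , refl | _ , _ , ()

  prependWalks-walks : ∀ {v ws} → All (Walk G fz v) ws → All (Walk prepend fz (fs (fs v))) (prependWalks ws)
  prependWalks-walks walks = All.++⁺ (All.map⁺ (All.map (cons refl ∘ cons refl ∘ Hom.Walk-map prepend-hom) walks))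
                                     (All.map⁺ (All.map (cons refl ∘ cons refl ∘ Hom.Walk-map prepend-hom) walks))

  unshift : ∀ {u v es} → Walk prepend (fs (fs u)) (fs (fs v)) es →
            ∃ λ es′ → es ≡ map shift es′ × Walk G u v es′
  unshift nil = [] , refl , nil
  unshift (cons {e = fs (fs (fs e))} refl w) with unshift w
  ... | es′ , refl , w′ = e ∷ es′ , refl , cons refl w′

  from-vertex-1 : ∀ {v ws} → (∀ {w} → Walk G fz v w → w ∈ ws) →
                  ∀ {w} → Walk prepend (fs fz) (fs (fs v)) w → ∃ λ r → w ≡ fs (fs fz) ∷ map shift r × r ∈ ws
  from-vertex-1 complete (cons {e = fs (fs fz)} refl w) with unshift w
  ... | r , refl , w′ = r , refl , complete w′

  prependWalks-complete : ∀ {v ws} → (∀ {w} → Walk G fz v w → w ∈ ws) →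
                          ∀ {w} → Walk prepend fz (fs (fs v)) w → w ∈ prependWalks ws
  prependWalks-complete complete (cons {e = fz} refl w) with from-vertex-1 complete w
  ... | r , refl , r∈ = ∈-++⁺ˡ (∈-map⁺ (via fz) r∈)
  prependWalks-complete complete (cons {e = fs fz} refl w) with from-vertex-1 complete w
  ... | r , refl , r∈ = ∈-++⁺ʳ (map (via fz) _) (∈-map⁺ (via (fs fz)) r∈)
  prependWalks-complete complete (cons {e = fs (fs fz)} () _)
  prependWalks-complete complete (cons {e = fs (fs (fs _))} () _)

δ : ∀ {n} → Fin n → Fin n → ℕ
δ a v = if does (a ≟ v) then 1 else 0

module _ {V : ℕ} (G : Digraph V) (a b : Fin V) where
  open Digraph G

  close : Digraph V
  close = record { m = suc m ; tail = tail⁺ ; head = head⁺ }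
    where
    tail⁺ head⁺ : Fin (suc m) → Fin V
    tail⁺ fz     = a
    tail⁺ (fs e) = tail e
    head⁺ fz     = b
    head⁺ (fs e) = head e

  close-hom : Hom G close
  close-hom = record { vertex = id ; edge = fs ; tail-edge = λ _ → refl ; head-edge = λ _ → refl }

  close-ranked : toℕ a < toℕ b → Ranked G → Ranked close
  close-ranked a<b ranked fz     = a<b
  close-ranked a<b ranked (fs e) = ranked e

  private
    tail⁺ head⁺ : Fin (suc m) → Fin V
    tail⁺ = Digraph.tail close
    head⁺ = Digraph.head close

  close-outdeg : ∀ v → outdeg close v ≡ δ a v + outdeg G v
  close-outdeg v with does (a ≟ v)
  ... | true  = cong suc (length-filter-tabulate (λ e → tail⁺ e ≟ v) (λ e → tail e ≟ v) fs id λ _ → refl)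
  ... | false = length-filter-tabulate (λ e → tail⁺ e ≟ v) (λ e → tail e ≟ v) fs id λ _ → refl

  close-indeg : ∀ v → indeg close v ≡ δ b v + indeg G v
  close-indeg v with does (b ≟ v)
  ... | true  = cong suc (length-filter-tabulate (λ e → head⁺ e ≟ v) (λ e → head e ≟ v) fs id λ _ → refl)
  ... | false = length-filter-tabulate (λ e → head⁺ e ≟ v) (λ e → head e ≟ v) fs id λ _ → refl

  module _ (a-source : IsSource G a) where

    unclose : ∀ {u v es} → Walk close u v es → u ≢ a → ∃ λ es′ → es ≡ map fs es′ × Walk G u v es′
    unclose nil _ = [] , refl , nil
    unclose (cons {e = fz} refl _) u≢a = ⊥-elim (u≢a refl)
    unclose (cons {e = fs e} refl w) _ with unclose w (a-source e)
    ... | es′ , refl , w′ = e ∷ es′ , refl , cons refl w′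

top : ℕ → ℕ
top zero    = 1
top (suc k) = 2 + top k

top-size : ∀ k → suc (top k) ≡ 2 * suc k
top-size zero    = refl
top-size (suc k) = trans (cong (2 +_) (top-size k)) (sym (*-suc 2 (suc k)))

-- chain k is 0 ⇉ 1 → 2 ⇉ 3 → ⋯ → 2k ⇉ 2k+1, built from its last 2-cycle by prepending the others.
chain : ∀ k → Digraph (suc (top k))
chain zero    = digon
chain (suc k) = prepend (chain k)

chain-sink : ∀ k → Fin (suc (top k))
chain-sink k = fromℕ (top k)

example : ∀ k → Digraph (suc (top k))
example k = close (chain k) fz (chain-sink k)

chain-ranked : ∀ k → Ranked (chain k)
chain-ranked zero    _ = s≤s z≤n
chain-ranked (suc k)   = prepend-ranked (chain k) (chain-ranked k)

example-ranked : ∀ k → Ranked (example k)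
example-ranked k =
  close-ranked (chain k) fz (chain-sink k) (subst (0 <_) (sym (toℕ-fromℕ (top k))) (top-pos k)) (chain-ranked k)
  where
  top-pos : ∀ k → 0 < top k
  top-pos zero    = s≤s z≤n
  top-pos (suc k) = s≤s z≤n

chain-degree : ∀ k v → δ fz v + δ (chain-sink k) v + degree (chain k) v ≡ 3
chain-degree zero fz      = refl
chain-degree zero (fs fz) = refl
chain-degree (suc k) fz      = cong suc (prepend-degree-0 (chain k))
chain-degree (suc k) (fs fz) = prepend-degree-1 (chain k)
chain-degree (suc k) (fs (fs fz)) =
  trans (cong (δ (chain-sink k) fz +_) (prepend-degree-2 (chain k))) (trans (+-suc _ _) (chain-degree k fz))
chain-degree (suc k) (fs (fs (fs w))) =
  trans (cong (δ (chain-sink k) (fs w) +_) (prepend-degree-shift (chain k) w)) (chain-degree k (fs w))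

example-regular : ∀ k → ThreeRegular (example k)
example-regular k v = begin
  outdeg (example k) v + indeg (example k) v
    ≡⟨ cong₂ _+_ (close-outdeg (chain k) fz (chain-sink k) v) (close-indeg (chain k) fz (chain-sink k) v) ⟩
  (δ fz v + outdeg (chain k) v) + (δ (chain-sink k) v + indeg (chain k) v)
    ≡⟨ interchange (δ fz v) _ _ _ ⟩
  (δ fz v + δ (chain-sink k) v) + degree (chain k) v
    ≡⟨ chain-degree k v ⟩
  3 ∎
  where open ≡-Reasoning

chain-in-edge : ∀ k v → v ≢ fz → ∃ λ e → Digraph.head (chain k) e ≡ v
chain-in-edge zero    fz      v≢0 = ⊥-elim (v≢0 refl)
chain-in-edge zero    (fs fz) _   = fz , refl
chain-in-edge (suc k) fz      v≢0 = ⊥-elim (v≢0 refl)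
chain-in-edge (suc k) (fs fz) _   = fz , refl
chain-in-edge (suc k) (fs (fs fz)) _ = fs (fs fz) , refl
chain-in-edge (suc k) (fs (fs (fs w))) _ with chain-in-edge k (fs w) (λ ())
... | e , he = fs (fs (fs e)) , cong (fs ∘ fs) he

chain-out-edge : ∀ k v → v ≢ chain-sink k → ∃ λ e → Digraph.tail (chain k) e ≡ v
chain-out-edge zero    fz      _   = fz , refl
chain-out-edge zero    (fs fz) v≢t = ⊥-elim (v≢t refl)
chain-out-edge (suc k) fz      _   = fz , refl
chain-out-edge (suc k) (fs fz) _   = fs (fs fz) , refl
chain-out-edge (suc k) (fs (fs w)) v≢t with chain-out-edge k w (v≢t ∘ cong (fs ∘ fs))
... | e , te = fs (fs (fs e)) , cong (fs ∘ fs) te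

example-source : ∀ k → IsUniqueSource (example k) fz
example-source k = source-by-in-edges (example k) (ranked-source (example k) (example-ranked k))
                     λ v v≢0 → fs (proj₁ (chain-in-edge k v v≢0)) , proj₂ (chain-in-edge k v v≢0)

example-sink : ∀ k → IsUniqueSink (example k) (chain-sink k)
example-sink k = sink-by-out-edges (example k) (ranked-sink (example k) (example-ranked k))
                   λ v v≢t → fs (proj₁ (chain-out-edge k v v≢t)) , proj₂ (chain-out-edge k v v≢t)

chain-connected : ∀ k v → UReach (chain k) (λ _ → ⊤) v fz
chain-connected zero    fz      = here
chain-connected zero    (fs fz) = bwd fz tt refl here
chain-connected (suc k) fz      = here
chain-connected (suc k) (fs fz) = bwd fz tt refl here
chain-connected (suc k) (fs (fs v)) =
  UReach-trans (chain (suc k)) (Hom.UReach-map (prepend-hom (chain k)) (λ _ _ → tt) (chain-connected k v))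
                               (bwd (fs (fs fz)) tt refl (bwd fz tt refl here))

chain-minus-edge : ∀ k d v → UReach (chain k) (_≢ d) v fz ⊎ UReach (chain k) (_≢ d) v (chain-sink k)
chain-minus-edge zero d fz      = inj₁ here
chain-minus-edge zero d (fs fz) = inj₂ here
chain-minus-edge (suc k) d fz = inj₁ here
chain-minus-edge (suc k) fz      (fs fz) = inj₁ (bwd (fs fz) (λ ()) refl here)
chain-minus-edge (suc k) (fs d)  (fs fz) = inj₁ (bwd fz (λ ()) refl here)
chain-minus-edge (suc k) fz (fs (fs v)) =
  inj₁ (UReach-trans (chain (suc k)) (Hom.UReach-map (prepend-hom (chain k)) (λ _ _ ()) (chain-connected k v))
                                     (bwd (fs (fs fz)) (λ ()) refl (bwd (fs fz) (λ ()) refl here)))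
chain-minus-edge (suc k) (fs fz) (fs (fs v)) =
  inj₁ (UReach-trans (chain (suc k)) (Hom.UReach-map (prepend-hom (chain k)) (λ _ _ ()) (chain-connected k v))
                                     (bwd (fs (fs fz)) (λ ()) refl (bwd fz (λ ()) refl here)))
chain-minus-edge (suc k) (fs (fs fz)) (fs (fs v)) =
  inj₂ (Hom.UReach-map (prepend-hom (chain k)) (λ _ _ ())
         (UReach-trans (chain k) (chain-connected k v) (UReach-sym (chain k) (chain-connected k (chain-sink k)))))
chain-minus-edge (suc k) (fs (fs (fs d))) (fs (fs v)) with chain-minus-edge k d v
... | inj₁ r = inj₁ (UReach-trans (chain (suc k)) (Hom.UReach-map (prepend-hom (chain k)) (λ _ → _∘ fs-injective³) r)
                                                  (bwd (fs (fs fz)) (λ ()) refl (bwd fz (λ ()) refl here)))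
... | inj₂ r = inj₂ (Hom.UReach-map (prepend-hom (chain k)) (λ _ → _∘ fs-injective³) r)

example-2ec : ∀ k → TwoEdgeConnected (example k)
example-2ec k =
  (λ u v → UReach-trans (example k) (lift (chain-connected k u)) (UReach-sym (example k) (lift (chain-connected k v)))) ,
  (λ d u v → UReach-trans (example k) (to-source d u) (UReach-sym (example k) (to-source d v)))
  where
  open Hom (close-hom (chain k) fz (chain-sink k)) using (UReach-map)
  lift : ∀ {u v} → UReach (chain k) (λ _ → ⊤) u v → UReach (example k) (λ _ → ⊤) u v
  lift = UReach-map (λ _ _ → tt)
  to-source : ∀ d u → UReach (example k) (_≢ d) u fz
  to-source fz u = UReach-map (λ _ _ ()) (chain-connected k u)
  to-source (fs d) u with chain-minus-edge k d u
  ... | inj₁ r = UReach-map (λ e e≢d → e≢d ∘ fs-injective) r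
  ... | inj₂ r = UReach-trans (example k) (UReach-map (λ e e≢d → e≢d ∘ fs-injective) r) (bwd fz (λ ()) refl here)

chainWalks : ∀ k → List (List (Fin (Digraph.m (chain k))))
chainWalks zero    = [ fz ] ∷ [ fs fz ] ∷ []
chainWalks (suc k) = prependWalks (chain k) (chainWalks k)

chainWalks-length : ∀ k → length (chainWalks k) ≡ 2 ^ suc k
chainWalks-length zero    = refl
chainWalks-length (suc k) = trans (prependWalks-length (chain k) (chainWalks k)) (cong (2 *_) (chainWalks-length k))

chainWalks-unique : ∀ k → Unique (chainWalks k)
chainWalks-unique zero    = ((λ ()) ∷ []) ∷ [] ∷ []
chainWalks-unique (suc k) = prependWalks-unique (chain k) (chainWalks-unique k)

chainWalks-walks : ∀ k → All (Walk (chain k) fz (chain-sink k)) (chainWalks k)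
chainWalks-walks zero    = cons refl nil ∷ cons refl nil ∷ []
chainWalks-walks (suc k) = prependWalks-walks (chain k) (chainWalks-walks k)

chainWalks-complete : ∀ k {w} → Walk (chain k) fz (chain-sink k) w → w ∈ chainWalks k
chainWalks-complete zero (cons {e = e} refl w) with walk-from-sink digon (λ _ ()) w
chainWalks-complete zero (cons {e = fz} refl w)    | refl = here refl
chainWalks-complete zero (cons {e = fs fz} refl w) | refl = there (here refl)
chainWalks-complete (suc k) w = prependWalks-complete (chain k) (chainWalks-complete k) w

exampleWalks : ∀ k → List (List (Fin (Digraph.m (example k))))
exampleWalks k = [ fz ] ∷ map (map fs) (chainWalks k)

exampleWalks-length : ∀ k → length (exampleWalks k) ≡ 2 ^ suc k + 1
exampleWalks-length k = trans (cong suc (trans (length-map (map fs) (chainWalks k)) (chainWalks-length k))) (+-comm 1 _)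

exampleWalks-unique : ∀ k → Unique (exampleWalks k)
exampleWalks-unique k = All.map⁺ (All.universal (λ { [] () ; (_ ∷ _) () }) (chainWalks k))
                      ∷ Unique.map⁺ (map-injective fs-injective) (chainWalks-unique k)

exampleWalks-paths : ∀ k → All (Path (example k) fz (chain-sink k)) (exampleWalks k)
exampleWalks-paths k = All.map (walk⇒path (example k) (example-ranked k))
  (cons refl nil ∷ All.map⁺ (All.map (Hom.Walk-map (close-hom (chain k) fz (chain-sink k))) (chainWalks-walks k)))

exampleWalks-complete : ∀ k w → Path (example k) fz (chain-sink k) w → w ∈ exampleWalks k
exampleWalks-complete k w (walk , _)
  with first-step (example k) walk (λ eq → <-irrefl (cong toℕ eq) (example-ranked k fz))
... | fz , _ , refl , _ , rest with Ranked⇒Acyclic (example k) (example-ranked k) _ _ rest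
...   | refl = here refl
exampleWalks-complete k w (walk , _) | fs e , _ , refl , te , rest
  with unclose (chain k) fz (chain-sink k) (ranked-source (chain k) (chain-ranked k)) rest
                 (ranked-source (chain k) (chain-ranked k) e)
... | es , refl , rest′ = there (∈-map⁺ (map fs) (chainWalks-complete k (cons te rest′)))

ExtremalGraph : ℕ → ℕ → Set
ExtremalGraph N n =
  Σ (Digraph N) λ D → TwoEdgeConnected D × ThreeRegular D × Acyclic D ×
    Σ (Fin N) λ s → Σ (Fin N) λ t → IsUniqueSource D s × IsUniqueSink D t ×
      Σ (List (List (Fin (Digraph.m D)))) λ ps → Unique ps × All (Path D s t) ps ×
        (∀ es → Path D s t es → es ∈ ps) × length ps ≡ 2 ^ n + 1

example-extremal : ∀ k → ExtremalGraph (suc (top k)) (suc k)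
example-extremal k =
  example k , example-2ec k , example-regular k , Ranked⇒Acyclic (example k) (example-ranked k) ,
  fz , chain-sink k , example-source k , example-sink k ,
  exampleWalks k , exampleWalks-unique k , exampleWalks-paths k , exampleWalks-complete k , exampleWalks-length k

extremal-exists : (n : ℕ) → 1 ≤ n → ExtremalGraph (2 * n) n
extremal-exists (suc k) _ = subst (λ N → ExtremalGraph N (suc k)) (top-size k) (example-extremal k)

corollary3p4 :
    ((n : ℕ) (D : Digraph (2 * n)) → TwoEdgeConnected D → ThreeRegular D → Acyclic D →
      (s t : Fin (2 * n)) → IsUniqueSource D s → IsUniqueSink D t →
      (ps : List (List (Fin (Digraph.m D)))) → Unique ps → All (Path D s t) ps →
      length ps ≤ 2 ^ n + 1)
    ×
    ((n : ℕ) → 1 ≤ n →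
      Σ (Digraph (2 * n)) λ D → TwoEdgeConnected D × ThreeRegular D × Acyclic D ×
        Σ (Fin (2 * n)) λ s → Σ (Fin (2 * n)) λ t → IsUniqueSource D s × IsUniqueSink D t ×
          Σ (List (List (Fin (Digraph.m D)))) λ ps → Unique ps × All (Path D s t) ps ×
            (∀ es → Path D s t es → es ∈ ps) × length ps ≡ 2 ^ n + 1)
corollary3p4 =
  (λ n D 2ec regular acyclic s t source sink _ → UpperBound.paths-bound D regular 2ec source sink acyclic {n} refl)
  , extremal-exists
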